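{- Let $\ell$ be a positive integer and $S\subseteq\{1,\dots,\ell\}$ a set containing both $1$ and $\ell$. Then, as $n\to\infty$, $\operatorname{th_{dim}}(\mathrm{Circ}(n,S))=\Theta(\sqrt n)$, where the implied constants depend on $\ell$.
   Context: The circulant graph $\mathrm{Circ}(n,S)$ has vertex set $\{1,\dots,n\}$, with $ij$ an edge iff $i-j$ or $j-i$ lies in $S$ modulo $n$. $\operatorname{dist}(u,v)$ is the shortest-path distance. For a nonnegative integer $r$, $\operatorname{dist}_r(x,v)=\min(\operatorname{dist}(x,v),r+1)$. A set $L\subseteq V(G)$ is a distance-$r$ resolving set if for all distinct $x,y\in V(G)$ there is $v\in L$ with $\operatorname{dist}_r(v,x)\ne\operatorname{dist}_r(v,y)$. $\dim_r(G)$ is the minimum size of such a set and $\operatorname{th_{dim}}(G)=\min_{r\ge0}(r+\dim_r(G))$ over nonnegative integers $r$. -}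

module Defs where

open import Data.Bool using (Bool; true; false; _∨_; _∧_; if_then_else_)
open import Data.Nat using (ℕ; zero; suc; _+_; _≡ᵇ_; NonZero)
open import Data.Nat.DivMod using (_%_)
open import Data.Fin using (Fin; toℕ; _≟_)
open import Data.Fin.Subset using (Subset; _∈_)
open import Data.List using (List; allFin)
open import Data.Bool.ListAction using (any)
open import Data.Product using (∃-syntax; _×_)
open import Relation.Binary.PropositionalEquality using (_≡_; _≢_)
open import Relation.Nullary.Decidable using (isYes)

-- Circulant graph Circ(n,S) on vertex set Fin n = {0,…,n-1}
-- (a relabelling of {1,…,n}).  i ~ j iff i - j ∈ S or j - i ∈ S (mod n),
-- i.e. i ≡ j + s or j ≡ i + s (mod n) for some s ∈ S.
adj : (n : ℕ) .{{_ : NonZero n}} → List ℕ → Fin n → Fin n → Bool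
adj n S i j = any (λ s → ((toℕ i + s) % n ≡ᵇ toℕ j) ∨ ((toℕ j + s) % n ≡ᵇ toℕ i)) S

within : (n : ℕ) .{{_ : NonZero n}} → List ℕ → ℕ → Fin n → Fin n → Bool
within n S zero    u w = isYes (u ≟ w)
within n S (suc k) u w =
  within n S k u w ∨ any (λ z → within n S k u z ∧ adj n S z w) (allFin n)

-- Truncated distance dist_r(u,w) = min(dist(u,w), r+1):
-- the least d ∈ {0,…,r} with dist(u,w) ≤ d, and r+1 if there is none.
distR : (n : ℕ) .{{_ : NonZero n}} → List ℕ → ℕ → Fin n → Fin n → ℕ
distR n S r u w = search 0 (suc r)
  where
  search : ℕ → ℕ → ℕ
  search d zero    = d
  search d (suc f) = if within n S d u w then d else search (suc d) f

IsResolving : (n : ℕ) .{{_ : NonZero n}} → List ℕ → ℕ → Subset n → Set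
IsResolving n S r L =
  ∀ (x y : Fin n) → x ≢ y → ∃[ v ] (v ∈ L × distR n S r v x ≢ distR n S r v y)

{-# OPTIONS --safe #-}
module Submission where

-- Every edge of Circ(n,S) moves at most ℓ around the cycle, so the vertices within distance r
-- of v lie in the cyclic interval [v - ℓr, v + ℓr].  For a distance-r resolving set L, every
-- vertex outside the union of these |L| intervals has distance vector (r+1, …, r+1), so at most
-- one vertex is uncovered and n ≤ |L|(2ℓr + 1) + 1 ≤ 2(ℓ + 1)(r + |L|)².
-- Conversely, take r = ⌊√n⌋ and cut the cycle into blocks of ℓ(r + 1) consecutive vertices; the
-- first ℓ vertices of each block are landmarks, about ℓ + n/(r + 1) ≤ 2r of them.  Every x is
-- e ≤ r steps of length ℓ after its landmark v, so dist_r(v, x) ≤ e; if y < x is far from x, then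
-- dist_r(v, y) > e, and if y is close to x, the landmark of y separates the pair in the same way,
-- since 4ℓr < n prevents walks from wrapping around.  Hence (r + |L|)² ≤ (3r)² ≤ 9n.

open import Defs
open import Data.Bool using (true; false; T; if_then_else_)
open import Data.Bool.Properties using (T-∨; T-∧)
open import Data.Empty using (⊥-elim)
open import Data.Fin using (Fin; zero; suc; toℕ; fromℕ<; _≟_)
open import Data.Fin.Properties using (toℕ-injective; toℕ<n; toℕ-fromℕ<; any?)
open import Data.Fin.Subset using (Subset; ∣_∣; ⁅_⁆; _∪_; ⊥; ⊤) renaming (_∈_ to _∈ₛ_; _∉_ to _∉ₛ_)
open import Data.Fin.Subset.Properties
  using (∣⁅x⁆∣≡1; ∣⊥∣≡0; ∣⊤∣≡n; x∈p∪q⁺; x∈⁅x⁆; p⊆q⇒∣p∣≤∣q∣; ∈⊤; _∈?_)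
open import Data.List using (List; allFin)
open import Data.List.Membership.Propositional using (_∈_; lose; find)
open import Data.List.Membership.Propositional.Properties using (∈-allFin)
open import Data.List.Relation.Unary.Any using (satisfied)
open import Data.List.Relation.Unary.Any.Properties using (any⁺; any⁻)
open import Data.Nat
  using (ℕ; zero; suc; pred; _+_; _*_; _^_; _∸_; _≤_; _<_; _≤′_; ≤′-refl; ≤′-step; _≡ᵇ_;
         NonZero; >-nonZero; z≤n; s≤s; s≤s⁻¹)
open import Data.Nat.Properties hiding (_≟_)
open import Data.Nat.DivMod
open import Data.Nat.Solver using (module +-*-Solver)
open import Data.Product using (∃-syntax; _×_; _,_; proj₂)
import Data.Sum
open import Data.Sum using (_⊎_; inj₁; inj₂; [_,_]′)
open import Data.Vec using ([]; _∷_; here; there)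
open import Function using (_∘_)
open import Function.Bundles using (Equivalence)
open import Relation.Binary.Definitions using (tri<; tri≈; tri>)
open import Relation.Binary.PropositionalEquality
open import Relation.Nullary using (¬_; yes; no; contradiction)
open import Relation.Nullary.Decidable using (isYes; ¬?; decidable-stable; toWitness; fromWitness)
open import Algebra.Properties.CommutativeSemigroup +-commutativeSemigroup using (xy∙z≈xz∙y; x∙yz≈y∙xz)

∣p∪q∣≤∣p∣+∣q∣ : ∀ {n} (p q : Subset n) → ∣ p ∪ q ∣ ≤ ∣ p ∣ + ∣ q ∣
∣p∪q∣≤∣p∣+∣q∣ []          []          = z≤n
∣p∪q∣≤∣p∣+∣q∣ (true ∷ p)  (true ∷ q)  = s≤s (≤-trans (∣p∪q∣≤∣p∣+∣q∣ p q) (+-monoʳ-≤ ∣ p ∣ (n≤1+n ∣ q ∣)))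
∣p∪q∣≤∣p∣+∣q∣ (true ∷ p)  (false ∷ q) = s≤s (∣p∪q∣≤∣p∣+∣q∣ p q)
∣p∪q∣≤∣p∣+∣q∣ (false ∷ p) (true ∷ q)  = ≤-trans (s≤s (∣p∪q∣≤∣p∣+∣q∣ p q)) (≤-reflexive (sym (+-suc ∣ p ∣ ∣ q ∣)))
∣p∪q∣≤∣p∣+∣q∣ (false ∷ p) (false ∷ q) = ∣p∪q∣≤∣p∣+∣q∣ p q

⋃[_] : ∀ {m n} → Subset m → (Fin m → Subset n) → Subset n
⋃[ [] ]        F = ⊥
⋃[ true ∷ p ]  F = F zero ∪ ⋃[ p ] (F ∘ suc)
⋃[ false ∷ p ] F = ⋃[ p ] (F ∘ suc)

x∈⋃[]⁺ : ∀ {m n} (p : Subset m) (F : Fin m → Subset n) {i x} → i ∈ₛ p → x ∈ₛ F i → x ∈ₛ ⋃[ p ] F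
x∈⋃[]⁺ (true ∷ p)  F here        x∈Fi = x∈p∪q⁺ (inj₁ x∈Fi)
x∈⋃[]⁺ (true ∷ p)  F (there i∈p) x∈Fi = x∈p∪q⁺ (inj₂ (x∈⋃[]⁺ p (F ∘ suc) i∈p x∈Fi))
x∈⋃[]⁺ (false ∷ p) F (there i∈p) x∈Fi = x∈⋃[]⁺ p (F ∘ suc) i∈p x∈Fi

∣⋃[]∣≤ : ∀ {m n} (p : Subset m) (F : Fin m → Subset n) {c} → (∀ i → ∣ F i ∣ ≤ c) → ∣ ⋃[ p ] F ∣ ≤ ∣ p ∣ * c
∣⋃[]∣≤ {n = n} []  F bound = ≤-reflexive (∣⊥∣≡0 n)
∣⋃[]∣≤ (true ∷ p)  F bound =
  ≤-trans (∣p∪q∣≤∣p∣+∣q∣ (F zero) _) (+-mono-≤ (bound zero) (∣⋃[]∣≤ p (F ∘ suc) (bound ∘ suc)))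
∣⋃[]∣≤ (false ∷ p) F bound = ∣⋃[]∣≤ p (F ∘ suc) (bound ∘ suc)

∣⋃[⊤]∣≤ : ∀ {m n} (F : Fin m → Subset n) {c} → (∀ i → ∣ F i ∣ ≤ c) → ∣ ⋃[ ⊤ ] F ∣ ≤ m * c
∣⋃[⊤]∣≤ {m} F {c} bound = subst (λ k → ∣ ⋃[ ⊤ ] F ∣ ≤ k * c) (∣⊤∣≡n m) (∣⋃[]∣≤ ⊤ F bound)

n≤1+∣p∣ : ∀ {n} (p : Subset n) → (∀ {x y} → x ∉ₛ p → y ∉ₛ p → x ≡ y) → n ≤ suc ∣ p ∣
n≤1+∣p∣ {n} p unique with any? (λ x → ¬? (x ∈? p))
... | no all∈p = begin
  n          ≡⟨ ∣⊤∣≡n n ⟨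
  ∣ ⊤ {n} ∣  ≤⟨ p⊆q⇒∣p∣≤∣q∣ {p = ⊤} (λ {x} _ → decidable-stable (x ∈? p) (λ x∉p → all∈p (x , x∉p))) ⟩
  ∣ p ∣      ≤⟨ n≤1+n ∣ p ∣ ⟩
  suc ∣ p ∣  ∎
  where open ≤-Reasoning
... | yes (x₀ , x₀∉p) = begin
  n                    ≡⟨ ∣⊤∣≡n n ⟨
  ∣ ⊤ {n} ∣            ≤⟨ p⊆q⇒∣p∣≤∣q∣ ⊤⊆p∪⁅x₀⁆ ⟩
  ∣ p ∪ ⁅ x₀ ⁆ ∣       ≤⟨ ∣p∪q∣≤∣p∣+∣q∣ p ⁅ x₀ ⁆ ⟩
  ∣ p ∣ + ∣ ⁅ x₀ ⁆ ∣   ≡⟨ cong (∣ p ∣ +_) (∣⁅x⁆∣≡1 x₀) ⟩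
  ∣ p ∣ + 1            ≡⟨ +-comm ∣ p ∣ 1 ⟩
  suc ∣ p ∣            ∎
  where
  open ≤-Reasoning
  ⊤⊆p∪⁅x₀⁆ : ∀ {x} → x ∈ₛ ⊤ → x ∈ₛ p ∪ ⁅ x₀ ⁆
  ⊤⊆p∪⁅x₀⁆ {x} _ with x ∈? p
  ... | yes x∈p = x∈p∪q⁺ (inj₁ x∈p)
  ... | no  x∉p = x∈p∪q⁺ (inj₂ (subst (_∈ₛ ⁅ x₀ ⁆) (sym (unique x∉p x₀∉p)) (x∈⁅x⁆ x₀)))

m%n%o+m/n*n+o*[m%n/o]≡m : ∀ m n o .{{_ : NonZero n}} .{{_ : NonZero o}} →
                          m % n % o + m / n * n + o * (m % n / o) ≡ m
m%n%o+m/n*n+o*[m%n/o]≡m m n o = begin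
  m % n % o + m / n * n + o * (m % n / o)   ≡⟨ xy∙z≈xz∙y (m % n % o) (m / n * n) (o * (m % n / o)) ⟩
  m % n % o + o * (m % n / o) + m / n * n   ≡⟨ cong (λ t → m % n % o + t + m / n * n) (*-comm o (m % n / o)) ⟩
  m % n % o + m % n / o * o + m / n * n     ≡⟨ cong (_+ m / n * n) (m≡m%n+[m/n]*n (m % n) o) ⟨
  m % n + m / n * n                         ≡⟨ m≡m%n+[m/n]*n m n ⟨
  m                                         ∎
  where open ≡-Reasoning

module CyclicDistance (n : ℕ) .{{_ : NonZero n}} where

  toℕ%n : (x : Fin n) → toℕ x % n ≡ toℕ x
  toℕ%n x = m<n⇒m%n≡m (toℕ<n x)

  %-congˡ-+ : ∀ {i j} k → i % n ≡ j % n → (i + k) % n ≡ (j + k) % n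
  %-congˡ-+ {i} {j} k i≡j = begin
    (i + k) % n                ≡⟨ %-distribˡ-+ i k n ⟩
    (i % n + k % n) % n        ≡⟨ cong (λ t → (t + k % n) % n) i≡j ⟩
    (j % n + k % n) % n        ≡⟨ %-distribˡ-+ j k n ⟨
    (j + k) % n                ∎
    where open ≡-Reasoning

  m%n+n≡m : ∀ {m} → n ≤ m → m < n + n → m % n + n ≡ m
  m%n+n≡m {m} n≤m m<n+n = begin
    m % n + n              ≡⟨ cong (λ t → t % n + n) (m∸n+n≡m n≤m) ⟨
    (m ∸ n + n) % n + n    ≡⟨ cong (_+ n) ([m+n]%n≡m%n (m ∸ n) n) ⟩
    (m ∸ n) % n + n        ≡⟨ cong (_+ n) (m<n⇒m%n≡m (m<n+o⇒m∸n<o m n m<n+n)) ⟩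
    m ∸ n + n              ≡⟨ m∸n+n≡m n≤m ⟩
    m                      ∎
    where open ≡-Reasoning

  m<n+n⇒m≡m%n⊎m≡m%n+n : ∀ {m} → m < n + n → m ≡ m % n ⊎ m ≡ m % n + n
  m<n+n⇒m≡m%n⊎m≡m%n+n {m} m<n+n with m <? n
  ... | yes m<n = inj₁ (sym (m<n⇒m%n≡m m<n))
  ... | no  m≮n = inj₂ (sym (m%n+n≡m (≮⇒≥ m≮n) m<n+n))

  record CyclicDist≤ (m i j : ℕ) : Set where
    constructor cyclicDist≤
    field
      ahead behind : ℕ
      ahead+behind≤m : ahead + behind ≤ m
      meet : (i + ahead) % n ≡ (j + behind) % n

  cyclicDist≤-refl : ∀ {i} → CyclicDist≤ 0 i i
  cyclicDist≤-refl = cyclicDist≤ 0 0 z≤n refl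

  cyclicDist≤-mono : ∀ {m m′ i j} → m ≤ m′ → CyclicDist≤ m i j → CyclicDist≤ m′ i j
  cyclicDist≤-mono m≤m′ (cyclicDist≤ a b a+b≤m meet) = cyclicDist≤ a b (≤-trans a+b≤m m≤m′) meet

  cyclicDist≤-forward : ∀ {m i k j} s → CyclicDist≤ m i k → (k + s) % n ≡ j % n → CyclicDist≤ (s + m) i j
  cyclicDist≤-forward {m} {i} {k} {j} s (cyclicDist≤ a b a+b≤m meet) k+s≡j =
    cyclicDist≤ (a + s) b bound meet′
    where
    bound : a + s + b ≤ s + m
    bound = subst (_≤ s + m) (sym (trans (xy∙z≈xz∙y a s b) (+-comm (a + b) s))) (+-monoʳ-≤ s a+b≤m)
    meet′ : (i + (a + s)) % n ≡ (j + b) % n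
    meet′ = begin
      (i + (a + s)) % n    ≡⟨ cong (_% n) (+-assoc i a s) ⟨
      (i + a + s) % n      ≡⟨ %-congˡ-+ s meet ⟩
      (k + b + s) % n      ≡⟨ cong (_% n) (xy∙z≈xz∙y k b s) ⟩
      (k + s + b) % n      ≡⟨ %-congˡ-+ b k+s≡j ⟩
      (j + b) % n          ∎
      where open ≡-Reasoning

  cyclicDist≤-backward : ∀ {m i k j} s → CyclicDist≤ m i k → (j + s) % n ≡ k % n → CyclicDist≤ (s + m) i j
  cyclicDist≤-backward {m} {i} {k} {j} s (cyclicDist≤ a b a+b≤m meet) j+s≡k =
    cyclicDist≤ a (s + b) (subst (_≤ s + m) (x∙yz≈y∙xz s a b) (+-monoʳ-≤ s a+b≤m)) meet′
    where
    meet′ : (i + a) % n ≡ (j + (s + b)) % n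
    meet′ = begin
      (i + a) % n          ≡⟨ meet ⟩
      (k + b) % n          ≡⟨ %-congˡ-+ b j+s≡k ⟨
      (j + s + b) % n      ≡⟨ cong (_% n) (+-assoc j s b) ⟩
      (j + (s + b)) % n    ∎
      where open ≡-Reasoning

  -- For i + m < n the representatives i + ahead and j + behind differ by 0 or n.
  cyclicDist≤-cases : ∀ {m i j} → CyclicDist≤ m i j → i + m < n → j < n →
                      (i ≤ j + m × j ≤ i + m) ⊎ i + n ≤ j + m
  cyclicDist≤-cases {m} {i} {j} (cyclicDist≤ a b a+b≤m meet) i+m<n j<n =
    Data.Sum.map no-wrap wrap (m<n+n⇒m≡m%n⊎m≡m%n+n j+b<n+n)
    where
    a≤m : a ≤ m
    a≤m = m+n≤o⇒m≤o a a+b≤m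
    b≤m : b ≤ m
    b≤m = m+n≤o⇒n≤o a a+b≤m
    j+b<n+n : j + b < n + n
    j+b<n+n = +-mono-<-≤ j<n (≤-trans b≤m (≤-trans (m≤n+m m i) (<⇒≤ i+m<n)))
    [j+b]%n≡i+a : (j + b) % n ≡ i + a
    [j+b]%n≡i+a = trans (sym meet) (m<n⇒m%n≡m (≤-<-trans (+-monoʳ-≤ i a≤m) i+m<n))
    no-wrap : j + b ≡ (j + b) % n → i ≤ j + m × j ≤ i + m
    no-wrap j+b≡[j+b]%n =
        ≤-trans (m≤m+n i a) (subst (_≤ j + m) j+b≡i+a (+-monoʳ-≤ j b≤m))
      , ≤-trans (m≤m+n j b) (subst (_≤ i + m) (sym j+b≡i+a) (+-monoʳ-≤ i a≤m))
      where
      j+b≡i+a : j + b ≡ i + a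
      j+b≡i+a = trans j+b≡[j+b]%n [j+b]%n≡i+a
    wrap : j + b ≡ (j + b) % n + n → i + n ≤ j + m
    wrap j+b≡[j+b]%n+n = begin
      i + n               ≤⟨ +-monoˡ-≤ n (m≤m+n i a) ⟩
      i + a + n           ≡⟨ cong (_+ n) [j+b]%n≡i+a ⟨
      (j + b) % n + n     ≡⟨ j+b≡[j+b]%n+n ⟨
      j + b               ≤⟨ +-monoʳ-≤ j b≤m ⟩
      j + m               ∎
      where open ≤-Reasoning

module Circulant (n : ℕ) .{{_ : NonZero n}} (S : List ℕ) where

  open CyclicDistance n

  adj⁺ : ∀ {s z w} → s ∈ S → (toℕ z + s) % n ≡ toℕ w % n → T (adj n S z w)
  adj⁺ {w = w} s∈S z+s≡w =
    any⁺ _ (lose s∈S (Equivalence.from T-∨ (inj₁ (≡⇒≡ᵇ _ _ (trans z+s≡w (toℕ%n w))))))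

  adj⁻ : ∀ {z w} → T (adj n S z w) →
         ∃[ s ] (s ∈ S × ((toℕ z + s) % n ≡ toℕ w % n ⊎ (toℕ w + s) % n ≡ toℕ z % n))
  adj⁻ {z} {w} adjacent with find (any⁻ _ S adjacent)
  ... | s , s∈S , step = s , s∈S , Data.Sum.map (modular w) (modular z) (Equivalence.to T-∨ step)
    where
    modular : ∀ {k} (x : Fin n) → T (k ≡ᵇ toℕ x) → k ≡ toℕ x % n
    modular x k≡x = trans (≡ᵇ⇒≡ _ _ k≡x) (sym (toℕ%n x))

  within-suc : ∀ {d u w} → T (within n S d u w) → T (within n S (suc d) u w)
  within-suc reached = Equivalence.from T-∨ (inj₁ reached)

  within-step : ∀ {d u z w} → T (within n S d u z) → T (adj n S z w) → T (within n S (suc d) u w)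
  within-step {z = z} reached adjacent =
    Equivalence.from T-∨ (inj₂ (any⁺ _ (lose (∈-allFin z) (Equivalence.from T-∧ (reached , adjacent)))))

  within-suc⁻ : ∀ {d u w} → T (within n S (suc d) u w) →
                T (within n S d u w) ⊎ ∃[ z ] (T (within n S d u z) × T (adj n S z w))
  within-suc⁻ reached with Equivalence.to T-∨ reached
  ... | inj₁ reached-earlier = inj₁ reached-earlier
  ... | inj₂ via-neighbour with satisfied (any⁻ _ (allFin n) via-neighbour)
  ...   | z , step = inj₂ (z , Equivalence.to T-∧ step)

  within-mono : ∀ {d d′ u w} → d ≤ d′ → T (within n S d u w) → T (within n S d′ u w)
  within-mono {d} {u = u} {w} d≤d′ = go (≤⇒≤′ d≤d′)
    where
    go : ∀ {d′} → d ≤′ d′ → T (within n S d u w) → T (within n S d′ u w)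
    go ≤′-refl                 reached = reached
    go {suc d′} (≤′-step d≤d′) reached = within-suc {d′} (go d≤d′ reached)

  within-iterate : ∀ {s} → s ∈ S → ∀ d {u w} → toℕ u + s * d ≡ toℕ w → T (within n S d u w)
  within-iterate {s} s∈S zero {u} {w} u+s*0≡w =
    subst (T ∘ within n S 0 u) (toℕ-injective u≡w) (fromWitness refl)
    where
    open ≡-Reasoning
    u≡w : toℕ u ≡ toℕ w
    u≡w = begin
      toℕ u           ≡⟨ +-identityʳ (toℕ u) ⟨
      toℕ u + 0       ≡⟨ cong (toℕ u +_) (*-zeroʳ s) ⟨
      toℕ u + s * 0   ≡⟨ u+s*0≡w ⟩
      toℕ w           ∎
  within-iterate {s} s∈S (suc d) {u} {w} u+s*[1+d]≡w =
    within-step {d} {u} {z} {w} (within-iterate s∈S d (sym (toℕ-fromℕ< z<n))) (adj⁺ s∈S z+s≡w)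
    where
    open ≡-Reasoning
    u+s*d+s≡w : toℕ u + s * d + s ≡ toℕ w
    u+s*d+s≡w = begin
      toℕ u + s * d + s     ≡⟨ +-assoc (toℕ u) (s * d) s ⟩
      toℕ u + (s * d + s)   ≡⟨ cong (toℕ u +_) (+-comm (s * d) s) ⟩
      toℕ u + (s + s * d)   ≡⟨ cong (toℕ u +_) (*-suc s d) ⟨
      toℕ u + s * suc d     ≡⟨ u+s*[1+d]≡w ⟩
      toℕ w                 ∎
    z<n : toℕ u + s * d < n
    z<n = ≤-<-trans (m≤m+n _ s) (subst (_< n) (sym u+s*d+s≡w) (toℕ<n w))
    z : Fin n
    z = fromℕ< z<n
    z+s≡w : (toℕ z + s) % n ≡ toℕ w % n
    z+s≡w = cong (_% n) (trans (cong (_+ s) (toℕ-fromℕ< z<n)) u+s*d+s≡w)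

  within⇒cyclicDist≤ : ∀ {ℓ} → (∀ s → s ∈ S → s ≤ ℓ) →
                       ∀ d {u w} → T (within n S d u w) → CyclicDist≤ (ℓ * d) (toℕ u) (toℕ w)
  within⇒cyclicDist≤ S≤ℓ zero reached with toWitness reached
  ... | refl = cyclicDist≤-mono z≤n cyclicDist≤-refl
  within⇒cyclicDist≤ {ℓ} S≤ℓ (suc d) {u} {w} reached with within-suc⁻ {d} {u} {w} reached
  ... | inj₁ reached-earlier =
    cyclicDist≤-mono (*-monoʳ-≤ ℓ (n≤1+n d)) (within⇒cyclicDist≤ S≤ℓ d {u} {w} reached-earlier)
  ... | inj₂ (z , reached-z , adjacent) with adj⁻ adjacent
  ...   | s , s∈S , step = cyclicDist≤-mono s+ℓd≤ℓ[1+d]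
          ([ cyclicDist≤-forward s to-z , cyclicDist≤-backward s to-z ]′ step)
    where
    to-z : CyclicDist≤ (ℓ * d) (toℕ u) (toℕ z)
    to-z = within⇒cyclicDist≤ S≤ℓ d {u} {z} reached-z
    s+ℓd≤ℓ[1+d] : s + ℓ * d ≤ ℓ * suc d
    s+ℓd≤ℓ[1+d] = subst (s + ℓ * d ≤_) (sym (*-suc ℓ d)) (+-monoˡ-≤ (ℓ * d) (S≤ℓ s s∈S))

  -- `distR` is a linear search local to its where-block; solving this block's
  -- unification problem gives that search the name `distR-search`.
  mutual
    distR-search : ℕ → Fin n → Fin n → ℕ → ℕ → ℕ
    distR-search = _

    private
      distR-search-unifies : ∀ r u w → distR n S (suc r) u w ≡ distR n S (suc r) u w
      distR-search-unifies r u w with suc r | 2 | r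
      ... | R | d | f = cong (λ t → if isYes (u ≟ w) then 0 else (if within n S 1 u w then 1 else t))
                             (refl {x = distR-search R u w d f})

  module _ {r : ℕ} {u w : Fin n} where

    private
      search : ℕ → ℕ → ℕ
      search = distR-search r u w

      search≤ : ∀ d f → search d f ≤ d + f
      search≤ d zero    = ≤-reflexive (sym (+-identityʳ d))
      search≤ d (suc f) with within n S d u w
      ... | true  = m≤m+n d (suc f)
      ... | false = ≤-trans (search≤ (suc d) f) (≤-reflexive (sym (+-suc d f)))

      search-stops : ∀ {d′} d f → T (within n S d′ u w) → d ≤ d′ → d′ < d + f → search d f ≤ d′
      search-stops d zero _ d≤d′ d′<d+0 =
        contradiction (subst (d <_) (+-identityʳ d) (≤-<-trans d≤d′ d′<d+0)) (n≮n d)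
      search-stops {d′} d (suc f) reached d≤d′ d′<d+f with within n S d u w in eq
      ... | true  = d≤d′
      ... | false with m≤n⇒m<n∨m≡n d≤d′
      ...   | inj₁ d<d′ = search-stops (suc d) f reached d<d′ (subst (d′ <_) (+-suc d f) d′<d+f)
      ...   | inj₂ refl = ⊥-elim (subst T eq reached)

      search-passes : ∀ {d′} d f → ¬ T (within n S d′ u w) → d′ < d + f → d′ < search d f
      search-passes {d′} d zero    _           d′<d+0 = subst (d′ <_) (+-identityʳ d) d′<d+0
      search-passes {d′} d (suc f) not-reached d′<d+f with within n S d u w in eq
      ... | true  = ≰⇒> (λ d≤d′ → not-reached (within-mono d≤d′ (subst T (sym eq) _)))
      ... | false = search-passes (suc d) f not-reached (subst (d′ <_) (+-suc d f) d′<d+f)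

    distR≤1+r : distR n S r u w ≤ suc r
    distR≤1+r = search≤ 0 (suc r)

    distR≤ : ∀ {d} → d ≤ r → T (within n S d u w) → distR n S r u w ≤ d
    distR≤ d≤r reached = search-stops 0 (suc r) reached z≤n (s≤s d≤r)

    <distR : ∀ {d} → d ≤ r → ¬ T (within n S d u w) → d < distR n S r u w
    <distR d≤r not-reached = search-passes 0 (suc r) not-reached (s≤s d≤r)

  distR-separates : ∀ {r d v x y} → d ≤ r → T (within n S d v x) → ¬ T (within n S d v y) →
                    distR n S r v x ≢ distR n S r v y
  distR-separates d≤r x-reached y-unreached =
    <⇒≢ (≤-<-trans (distR≤ d≤r x-reached) (<distR d≤r y-unreached))

  distR≡1+r : ∀ {r u w} → ¬ T (within n S r u w) → distR n S r u w ≡ suc r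
  distR≡1+r not-reached = ≤-antisym distR≤1+r (<distR ≤-refl not-reached)

  module Landmarks (ℓ r : ℕ) {{_ : NonZero ℓ}} where

    block : ℕ
    block = ℓ * suc r

    instance
      block-nonZero : NonZero block
      block-nonZero = m*n≢0 ℓ (suc r)

    landmarkAt : Fin (suc (n / block)) → Fin ℓ → Fin n
    landmarkAt q c = (toℕ c + toℕ q * block) mod n

    blockLandmarks : Fin (suc (n / block)) → Subset n
    blockLandmarks q = ⋃[ ⊤ ] (⁅_⁆ ∘ landmarkAt q)

    landmarks : Subset n
    landmarks = ⋃[ ⊤ ] blockLandmarks

    ∣landmarks∣≤ : ∣ landmarks ∣ ≤ suc (n / block) * ℓ
    ∣landmarks∣≤ = ∣⋃[⊤]∣≤ blockLandmarks λ q →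
      subst (∣ blockLandmarks q ∣ ≤_) (*-identityʳ ℓ)
            (∣⋃[⊤]∣≤ (⁅_⁆ ∘ landmarkAt q) (≤-reflexive ∘ ∣⁅x⁆∣≡1 ∘ landmarkAt q))

    record Anchor (x : Fin n) : Set where
      field
        landmark : Fin n
        steps : ℕ
        steps≤r : steps ≤ r
        landmark+ℓ*steps≡x : toℕ landmark + ℓ * steps ≡ toℕ x
        landmark∈landmarks : landmark ∈ₛ landmarks

    -- x = q * block + e * ℓ + c with c < ℓ and e ≤ r; its landmark is q * block + c.
    anchor : ∀ x → Anchor x
    anchor x = record
      { landmark           = v
      ; steps              = e
      ; steps≤r            = e≤r
      ; landmark+ℓ*steps≡x = trans (cong (_+ ℓ * e) toℕ-v) c+q*block+ℓ*e≡x
      ; landmark∈landmarks =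
          x∈⋃[]⁺ ⊤ blockLandmarks {q′} ∈⊤ (x∈⋃[]⁺ ⊤ (⁅_⁆ ∘ landmarkAt q′) {c′} ∈⊤ (x∈⁅x⁆ v))
      }
      where
      open ≡-Reasoning
      X = toℕ x
      q = X / block
      e = X % block / ℓ
      c = X % block % ℓ
      q<1+n/block : q < suc (n / block)
      q<1+n/block = s≤s (/-monoˡ-≤ block (<⇒≤ (toℕ<n x)))
      c<ℓ : c < ℓ
      c<ℓ = m%n<n (X % block) ℓ
      q′ = fromℕ< q<1+n/block
      c′ = fromℕ< c<ℓ
      v : Fin n
      v = landmarkAt q′ c′
      e≤r : e ≤ r
      e≤r = s≤s⁻¹ (*-cancelʳ-< ℓ e (suc r)
              (≤-<-trans (m/n*n≤m (X % block) ℓ) (subst (X % block <_) (*-comm ℓ (suc r)) (m%n<n X block))))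
      c+q*block+ℓ*e≡x : c + q * block + ℓ * e ≡ X
      c+q*block+ℓ*e≡x = m%n%o+m/n*n+o*[m%n/o]≡m X block ℓ
      c+q*block<n : c + q * block < n
      c+q*block<n = ≤-<-trans (subst (c + q * block ≤_) c+q*block+ℓ*e≡x (m≤m+n _ (ℓ * e))) (toℕ<n x)
      toℕ-v : toℕ v ≡ c + q * block
      toℕ-v = begin
        toℕ v                              ≡⟨ toℕ-fromℕ< (m%n<n _ n) ⟩
        (toℕ c′ + toℕ q′ * block) % n      ≡⟨ cong₂ (λ i j → (i + j * block) % n) (toℕ-fromℕ< c<ℓ) (toℕ-fromℕ< q<1+n/block) ⟩
        (c + q * block) % n                ≡⟨ m<n⇒m%n≡m c+q*block<n ⟩
        c + q * block                      ∎

    module _ (S≤ℓ : ∀ s → s ∈ S → s ≤ ℓ) (ℓ∈S : ℓ ∈ S)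
             (4ℓr<n : ℓ * r + ℓ * r + (ℓ * r + ℓ * r) < n) where

      private
        K : ℕ
        K = ℓ * r

      far-unreached : ∀ {v e x y} → e ≤ r → toℕ v + ℓ * e ≡ toℕ x → toℕ y + (K + K) < toℕ x →
                      ¬ T (within n S e v y)
      far-unreached {v} {e} {x} {y} e≤r v+ℓe≡x far reached
        with cyclicDist≤-cases (within⇒cyclicDist≤ S≤ℓ e reached) (subst (_< n) (sym v+ℓe≡x) (toℕ<n x)) (toℕ<n y)
      ... | inj₁ (v≤y+ℓe , _) = n≮n (toℕ x) (begin-strict
        toℕ x                   ≡⟨ v+ℓe≡x ⟨
        toℕ v + ℓ * e           ≤⟨ +-monoˡ-≤ (ℓ * e) v≤y+ℓe ⟩
        toℕ y + ℓ * e + ℓ * e   ≤⟨ +-mono-≤ (+-monoʳ-≤ (toℕ y) ℓe≤K) ℓe≤K ⟩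
        toℕ y + K + K           ≡⟨ +-assoc (toℕ y) K K ⟩
        toℕ y + (K + K)         <⟨ far ⟩
        toℕ x                   ∎)
        where
        open ≤-Reasoning
        ℓe≤K : ℓ * e ≤ K
        ℓe≤K = *-monoʳ-≤ ℓ e≤r
      ... | inj₂ v+n≤y+ℓe = n≮n n (begin-strict
        n                       ≤⟨ m≤n+m n (toℕ v) ⟩
        toℕ v + n               ≤⟨ v+n≤y+ℓe ⟩
        toℕ y + ℓ * e           ≤⟨ +-monoʳ-≤ (toℕ y) (≤-trans (*-monoʳ-≤ ℓ e≤r) (m≤m+n K K)) ⟩
        toℕ y + (K + K)         <⟨ far ⟩
        toℕ x                   <⟨ toℕ<n x ⟩
        n                       ∎)
        where open ≤-Reasoning

      near-unreached : ∀ {w e x y} → e ≤ r → toℕ w + ℓ * e ≡ toℕ y → toℕ y < toℕ x → toℕ x ≤ toℕ y + (K + K) →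
                       ¬ T (within n S e w x)
      near-unreached {w} {e} {x} {y} e≤r w+ℓe≡y y<x near reached
        with cyclicDist≤-cases (within⇒cyclicDist≤ S≤ℓ e reached) (subst (_< n) (sym w+ℓe≡y) (toℕ<n y)) (toℕ<n x)
      ... | inj₁ (_ , x≤w+ℓe) = n≮n (toℕ x) (begin-strict
        toℕ x                   ≤⟨ x≤w+ℓe ⟩
        toℕ w + ℓ * e           ≡⟨ w+ℓe≡y ⟩
        toℕ y                   <⟨ y<x ⟩
        toℕ x                   ∎)
        where open ≤-Reasoning
      ... | inj₂ w+n≤x+ℓe = n≮n (toℕ y + n) (begin-strict
        toℕ y + n                   ≡⟨ cong (_+ n) w+ℓe≡y ⟨
        toℕ w + ℓ * e + n           ≡⟨ xy∙z≈xz∙y (toℕ w) (ℓ * e) n ⟩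
        toℕ w + n + ℓ * e           ≤⟨ +-monoˡ-≤ (ℓ * e) w+n≤x+ℓe ⟩
        toℕ x + ℓ * e + ℓ * e       ≤⟨ +-mono-≤ (+-mono-≤ near ℓe≤K) ℓe≤K ⟩
        toℕ y + (K + K) + K + K     ≡⟨ +-assoc (toℕ y + (K + K)) K K ⟩
        toℕ y + (K + K) + (K + K)   ≡⟨ +-assoc (toℕ y) (K + K) (K + K) ⟩
        toℕ y + (K + K + (K + K))   <⟨ +-monoʳ-< (toℕ y) 4ℓr<n ⟩
        toℕ y + n                   ∎)
        where
        open ≤-Reasoning
        ℓe≤K : ℓ * e ≤ K
        ℓe≤K = *-monoʳ-≤ ℓ e≤r

      landmarks-separate : ∀ {x y} → toℕ y < toℕ x →
                           ∃[ v ] (v ∈ₛ landmarks × distR n S r v x ≢ distR n S r v y)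
      landmarks-separate {x} {y} y<x with toℕ y + (K + K) <? toℕ x
      ... | yes far = landmark , landmark∈landmarks ,
          distR-separates steps≤r (within-iterate ℓ∈S steps landmark+ℓ*steps≡x)
                                  (far-unreached steps≤r landmark+ℓ*steps≡x far)
        where open Anchor (anchor x)
      ... | no near = landmark , landmark∈landmarks ,
          ≢-sym (distR-separates steps≤r (within-iterate ℓ∈S steps landmark+ℓ*steps≡x)
                                         (near-unreached steps≤r landmark+ℓ*steps≡x y<x (≮⇒≥ near)))
        where open Anchor (anchor y)

      landmarks-resolving : IsResolving n S r landmarks
      landmarks-resolving x y x≢y with <-cmp (toℕ x) (toℕ y)
      ... | tri< x<y _ _ with landmarks-separate x<y
      ...   | v , v∈landmarks , separates = v , v∈landmarks , ≢-sym separates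
      landmarks-resolving x y x≢y | tri≈ _ x≡y _ = contradiction (toℕ-injective x≡y) x≢y
      landmarks-resolving x y x≢y | tri> _ _ y<x = landmarks-separate y<x

  module Covering {ℓ : ℕ} (S≤ℓ : ∀ s → s ∈ S → s ≤ ℓ) (r : ℕ) where

    private
      K : ℕ
      K = ℓ * r

    -- Adding pred n * K subtracts K modulo n, so ball v is the cyclic interval [v - K, v + K].
    ballPoint : Fin n → Fin (suc (K + K)) → Fin n
    ballPoint v t = (toℕ v + toℕ t + pred n * K) mod n

    ball : Fin n → Subset n
    ball v = ⋃[ ⊤ ] (⁅_⁆ ∘ ballPoint v)

    ∣ball∣≤ : ∀ v → ∣ ball v ∣ ≤ suc (K + K)
    ∣ball∣≤ v = subst (∣ ball v ∣ ≤_) (*-identityʳ (suc (K + K)))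
                      (∣⋃[⊤]∣≤ (⁅_⁆ ∘ ballPoint v) (≤-reflexive ∘ ∣⁅x⁆∣≡1 ∘ ballPoint v))

    within⇒∈ball : ∀ {v x} → T (within n S r v x) → x ∈ₛ ball v
    within⇒∈ball {v} {x} reached with within⇒cyclicDist≤ S≤ℓ r {v} {x} reached
    ... | cyclicDist≤ a b a+b≤K meet =
      x∈⋃[]⁺ ⊤ (⁅_⁆ ∘ ballPoint v) {t′} ∈⊤ (subst (λ p → x ∈ₛ ⁅ p ⁆) (sym ballPoint≡x) (x∈⁅x⁆ x))
      where
      open ≡-Reasoning
      b≤K : b ≤ K
      b≤K = m+n≤o⇒n≤o a a+b≤K
      t<1+2K : a + (K ∸ b) < suc (K + K)
      t<1+2K = s≤s (+-mono-≤ (m+n≤o⇒m≤o a a+b≤K) (m∸n≤m K b))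
      t′ = fromℕ< t<1+2K
      x+b+[K∸b+[n-1]K]≡x+Kn : toℕ x + b + (K ∸ b + pred n * K) ≡ toℕ x + K * n
      x+b+[K∸b+[n-1]K]≡x+Kn = begin
        toℕ x + b + (K ∸ b + pred n * K)     ≡⟨ +-assoc (toℕ x) b _ ⟩
        toℕ x + (b + (K ∸ b + pred n * K))   ≡⟨ cong (toℕ x +_) (+-assoc b (K ∸ b) (pred n * K)) ⟨
        toℕ x + (b + (K ∸ b) + pred n * K)   ≡⟨ cong (λ k → toℕ x + (k + pred n * K)) (m+[n∸m]≡n b≤K) ⟩
        toℕ x + suc (pred n) * K             ≡⟨ cong (λ k → toℕ x + k * K) (suc-pred n) ⟩
        toℕ x + n * K                        ≡⟨ cong (toℕ x +_) (*-comm n K) ⟩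
        toℕ x + K * n                        ∎
      ballPoint≡x : ballPoint v t′ ≡ x
      ballPoint≡x = toℕ-injective (begin
        toℕ (ballPoint v t′)                      ≡⟨ toℕ-fromℕ< (m%n<n _ n) ⟩
        (toℕ v + toℕ t′ + pred n * K) % n         ≡⟨ cong (λ i → (toℕ v + i + pred n * K) % n) (toℕ-fromℕ< t<1+2K) ⟩
        (toℕ v + (a + (K ∸ b)) + pred n * K) % n  ≡⟨ cong (λ i → (i + pred n * K) % n) (+-assoc (toℕ v) a (K ∸ b)) ⟨
        (toℕ v + a + (K ∸ b) + pred n * K) % n    ≡⟨ cong (_% n) (+-assoc (toℕ v + a) (K ∸ b) (pred n * K)) ⟩
        (toℕ v + a + (K ∸ b + pred n * K)) % n    ≡⟨ %-congˡ-+ (K ∸ b + pred n * K) meet ⟩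
        (toℕ x + b + (K ∸ b + pred n * K)) % n    ≡⟨ cong (_% n) x+b+[K∸b+[n-1]K]≡x+Kn ⟩
        (toℕ x + K * n) % n                       ≡⟨ [m+kn]%n≡m%n (toℕ x) K n ⟩
        toℕ x % n                                 ≡⟨ toℕ%n x ⟩
        toℕ x                                     ∎)

    module _ {L : Subset n} (resolving : IsResolving n S r L) where

      uncovered-unique : ∀ {x y} → x ∉ₛ ⋃[ L ] ball → y ∉ₛ ⋃[ L ] ball → x ≡ y
      uncovered-unique {x} {y} x-uncovered y-uncovered = decidable-stable (x ≟ y) λ x≢y →
        let v , v∈L , separates = resolving x y x≢y
        in separates (trans (saturated x-uncovered v∈L) (sym (saturated y-uncovered v∈L)))
        where
        saturated : ∀ {z v} → z ∉ₛ ⋃[ L ] ball → v ∈ₛ L → distR n S r v z ≡ suc r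
        saturated z-uncovered v∈L =
          distR≡1+r (λ reached → z-uncovered (x∈⋃[]⁺ L ball v∈L (within⇒∈ball reached)))

      n≤1+∣L∣*[1+2ℓr] : n ≤ suc (∣ L ∣ * suc (ℓ * r + ℓ * r))
      n≤1+∣L∣*[1+2ℓr] = ≤-trans (n≤1+∣p∣ (⋃[ L ] ball) uncovered-unique) (s≤s (∣⋃[]∣≤ L ball ∣ball∣≤))

floor-sqrt : ∀ m → ∃[ k ] (k * k ≤ m × m < suc k * suc k)
floor-sqrt zero = 0 , z≤n , s≤s z≤n
floor-sqrt (suc m) with floor-sqrt m
... | k , k*k≤m , m<[1+k]² with suc m <? suc k * suc k
...   | yes 1+m<[1+k]² = k , m≤n⇒m≤1+n k*k≤m , 1+m<[1+k]²
...   | no  1+m≮[1+k]² = suc k , ≤-reflexive [1+k]²≡1+m ,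
                         subst (_< suc (suc k) * suc (suc k)) [1+k]²≡1+m (*-mono-< (n<1+n (suc k)) (n<1+n (suc k)))
  where
  [1+k]²≡1+m : suc k * suc k ≡ suc m
  [1+k]²≡1+m = ≤-antisym (≮⇒≥ 1+m≮[1+k]²) m<[1+k]²

module _ where
  open +-*-Solver

  [k+[k+k]]²≡9k² : ∀ k → (k + (k + k)) ^ 2 ≡ 9 * (k * k)
  [k+[k+k]]²≡9k² = solve 1 (λ k → (k :+ (k :+ k)) :^ 2 := con 9 :* (k :* k)) refl

  4ℓk≡ℓk+ℓk+[ℓk+ℓk] : ∀ ℓ k → 4 * ℓ * k ≡ ℓ * k + ℓ * k + (ℓ * k + ℓ * k)
  4ℓk≡ℓk+ℓk+[ℓk+ℓk] = solve 2 (λ ℓ k → con 4 :* ℓ :* k := ℓ :* k :+ ℓ :* k :+ (ℓ :* k :+ ℓ :* k)) refl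

  s[2s+2ℓs]≡2[1+ℓ]s² : ∀ ℓ s → s * (2 * s + (ℓ * s + ℓ * s)) ≡ 2 * suc ℓ * s ^ 2
  s[2s+2ℓs]≡2[1+ℓ]s² = solve 2 (λ ℓ s → s :* (con 2 :* s :+ (ℓ :* s :+ ℓ :* s)) := con 2 :* (con 1 :+ ℓ) :* s :^ 2) refl

n≤1+m[1+2ℓr]⇒n≤2[1+ℓ][r+m]² : ∀ ℓ r m {n} → 2 ≤ n → n ≤ suc (m * suc (ℓ * r + ℓ * r)) →
                              n ≤ 2 * suc ℓ * (r + m) ^ 2
n≤1+m[1+2ℓr]⇒n≤2[1+ℓ][r+m]² ℓ r zero    2≤n n≤1 = contradiction (≤-trans 2≤n n≤1) λ { (s≤s ()) }
n≤1+m[1+2ℓr]⇒n≤2[1+ℓ][r+m]² ℓ r m@(suc _) {n} 2≤n n≤1+m[1+2ℓr] = begin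
  n                                 ≤⟨ n≤1+m[1+2ℓr] ⟩
  suc (m * suc (ℓ * r + ℓ * r))     ≤⟨ +-monoˡ-≤ _ (s≤s z≤n) ⟩
  m + m * suc (ℓ * r + ℓ * r)       ≡⟨ *-suc m _ ⟨
  m * (2 + (ℓ * r + ℓ * r))         ≤⟨ *-mono-≤ m≤s (+-mono-≤ 2≤2s (+-mono-≤ ℓr≤ℓs ℓr≤ℓs)) ⟩
  s * (2 * s + (ℓ * s + ℓ * s))     ≡⟨ s[2s+2ℓs]≡2[1+ℓ]s² ℓ s ⟩
  2 * suc ℓ * s ^ 2                 ∎
  where
  open ≤-Reasoning
  s = r + m
  m≤s : m ≤ s
  m≤s = m≤n+m m r
  2≤2s : 2 ≤ 2 * s
  2≤2s = *-monoʳ-≤ 2 (≤-trans (s≤s z≤n) m≤s)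
  ℓr≤ℓs : ℓ * r ≤ ℓ * s
  ℓr≤ℓs = *-monoʳ-≤ ℓ (m≤m+n r m)

∃-resolving-[r+∣L∣]²≤9n : ∀ {ℓ} {{_ : NonZero ℓ}} {S} → (∀ s → s ∈ S → s ≤ ℓ) → ℓ ∈ S →
                          ∀ n .{{_ : NonZero n}} → suc (4 * ℓ) * suc (4 * ℓ) ≤ n →
                          ∃[ r ] ∃[ L ] (IsResolving n S r L × (r + ∣ L ∣) ^ 2 ≤ 9 * n)
∃-resolving-[r+∣L∣]²≤9n {ℓ} {S} S≤ℓ ℓ∈S n N≤n with floor-sqrt n
... | k , k*k≤n , n<[1+k]² = k , landmarks , landmarks-resolving S≤ℓ ℓ∈S 4ℓk<n , square-bound
  where
  open Circulant.Landmarks n S ℓ k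
  open ≤-Reasoning
  4ℓ<k : 4 * ℓ < k
  4ℓ<k = ≰⇒> λ k≤4ℓ → n≮n n (<-≤-trans n<[1+k]² (≤-trans (*-mono-≤ (s≤s k≤4ℓ) (s≤s k≤4ℓ)) N≤n))
  instance
    k-nonZero : NonZero k
    k-nonZero = >-nonZero (≤-<-trans z≤n 4ℓ<k)
  4ℓk<n : ℓ * k + ℓ * k + (ℓ * k + ℓ * k) < n
  4ℓk<n = subst (_< n) (4ℓk≡ℓk+ℓk+[ℓk+ℓk] ℓ k) (<-≤-trans (*-monoˡ-< k 4ℓ<k) k*k≤n)
  [n/block]ℓ≤k : n / block * ℓ ≤ k
  [n/block]ℓ≤k = s≤s⁻¹ (*-cancelʳ-< (suc k) (n / block * ℓ) (suc k) (begin-strict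
    n / block * ℓ * suc k      ≡⟨ *-assoc (n / block) ℓ (suc k) ⟩
    n / block * block          ≤⟨ m/n*n≤m n block ⟩
    n                          <⟨ n<[1+k]² ⟩
    suc k * suc k              ∎))
  ∣landmarks∣≤k+k : ∣ landmarks ∣ ≤ k + k
  ∣landmarks∣≤k+k = ≤-trans ∣landmarks∣≤ (+-mono-≤ (≤-trans (m≤m+n ℓ (3 * ℓ)) (<⇒≤ 4ℓ<k)) [n/block]ℓ≤k)
  square-bound : (k + ∣ landmarks ∣) ^ 2 ≤ 9 * n
  square-bound = begin
    (k + ∣ landmarks ∣) ^ 2    ≤⟨ ^-monoˡ-≤ 2 (+-monoʳ-≤ k ∣landmarks∣≤k+k) ⟩
    (k + (k + k)) ^ 2          ≡⟨ [k+[k+k]]²≡9k² k ⟩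
    9 * (k * k)                ≤⟨ *-monoʳ-≤ 9 k*k≤n ⟩
    9 * n                      ∎

resolving⇒n≤2[1+ℓ][r+∣L∣]² : ∀ {ℓ S} → (∀ s → s ∈ S → s ≤ ℓ) → ∀ n .{{_ : NonZero n}} → 2 ≤ n →
                             ∀ r (L : Subset n) → IsResolving n S r L → n ≤ 2 * suc ℓ * (r + ∣ L ∣) ^ 2
resolving⇒n≤2[1+ℓ][r+∣L∣]² {ℓ} {S} S≤ℓ n 2≤n r L resolving =
  n≤1+m[1+2ℓr]⇒n≤2[1+ℓ][r+m]² ℓ r ∣ L ∣ 2≤n (Circulant.Covering.n≤1+∣L∣*[1+2ℓr] n S S≤ℓ r resolving)

mainTheorem17 : ∀ (ℓ : ℕ) → 1 ≤ ℓ → (S : List ℕ) → (∀ s → s ∈ S → 1 ≤ s × s ≤ ℓ) → 1 ∈ S → ℓ ∈ S →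
    ∃[ a ] ∃[ b ] ∃[ N ] (∀ (n : ℕ) .{{_ : NonZero n}} → N ≤ n →
      (∃[ r ] ∃[ L ] (IsResolving n S r L × (r + ∣ L ∣) ^ 2 ≤ b * n))
      × (∀ (r : ℕ) (L : Subset n) → IsResolving n S r L → n ≤ a * (r + ∣ L ∣) ^ 2))
mainTheorem17 ℓ 1≤ℓ S S⊆[1,ℓ] _ ℓ∈S = 2 * suc ℓ , 9 , suc (4 * ℓ) * suc (4 * ℓ) , λ n N≤n →
  ∃-resolving-[r+∣L∣]²≤9n S≤ℓ ℓ∈S n N≤n , resolving⇒n≤2[1+ℓ][r+∣L∣]² S≤ℓ n (≤-trans 2≤N N≤n)
  where
  instance
    ℓ-nonZero : NonZero ℓ
    ℓ-nonZero = >-nonZero 1≤ℓ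
  S≤ℓ : ∀ s → s ∈ S → s ≤ ℓ
  S≤ℓ s s∈S = proj₂ (S⊆[1,ℓ] s s∈S)
  2≤N : 2 ≤ suc (4 * ℓ) * suc (4 * ℓ)
  2≤N = ≤-trans (s≤s (≤-trans 1≤ℓ (m≤m+n ℓ (3 * ℓ)))) (m≤m*n (suc (4 * ℓ)) (suc (4 * ℓ)))
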